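{- Let $K$ be a field and let $M\in M_{n,n}(K)$. There exists a regular matrix ${}^dM\in M_{n,n}(K)$ such that $({}^dM)^s$ is similar to $M$.
   Context: For $N\in M_{n,n}(K)$ with entries $N_{i,j}$, the sequential mapping $N^\downarrow:K^n\to K^n$ sends $X=(x_1,\dots,x_n)$ to the vector obtained by executing in place on $X$ the program "for $i$ from $1$ to $n$ do $x_i:=\sum_{j=1}^n N_{i,j}x_j$" (each assignment uses the current values of the components, some of which have already been overwritten). This map is linear, and $N^s\in M_{n,n}(K)$ denotes the matrix representing it, i.e. $N^s X=N^\downarrow(X)$ for all $X\in K^n$. A matrix is regular if all its diagonal entries equal $1$. A matrix $M'$ is similar to $M$ if $M'_{i,j}=M_{i,j}$ for all $i\neq j$ (they may differ only on the diagonal). -}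

module Defs where

open import Level using (Level; _⊔_)
open import Algebra.Bundles using (CommutativeRing)
open import Data.Nat using (ℕ)
open ℕ
open import Data.Fin using (Fin; _≟_)
open Fin
open import Data.List using (List; []; _∷_; allFin)
open import Data.Vec.Functional using (Vector; updateAt)
open import Data.Product using (Σ; _×_)
open import Relation.Nullary using (¬_; does)
open import Data.Bool using (if_then_else_)
open import Relation.Binary.PropositionalEquality using (_≡_)

record Field (c ℓ : Level) : Set (Level.suc (c ⊔ ℓ)) where
  field
    commutativeRing : CommutativeRing c ℓ
  open CommutativeRing commutativeRing public
  field
    0≉1     : ¬ (0# ≈ 1#)
    inverse : ∀ x → ¬ (x ≈ 0#) → Σ Carrier λ y → x * y ≈ 1#

module FieldMatrices {c ℓ : Level} (K : Field c ℓ) where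
  open Field K using (Carrier; _≈_; _+_; _*_; 0#; 1#)

  Matrix : ℕ → Set c
  Matrix n = Fin n → Fin n → Carrier

  ∑ : ∀ {n} → (Fin n → Carrier) → Carrier
  ∑ {zero}  f = 0#
  ∑ {suc n} f = f zero + ∑ {n} (λ j → f (suc j))

  step : ∀ {n} → Matrix n → Fin n → Vector Carrier n → Vector Carrier n
  step N i X = updateAt X i (λ _ → ∑ (λ j → N i j * X j))

  run : ∀ {n} → Matrix n → List (Fin n) → Vector Carrier n → Vector Carrier n
  run N []       X = X
  run N (i ∷ is) X = run N is (step N i X)

  seqMap : ∀ {n} → Matrix n → Vector Carrier n → Vector Carrier n
  seqMap {n} N X = run N (allFin n) X

  basis : ∀ {n} → Fin n → Vector Carrier n
  basis j k = if does (j ≟ k) then 1# else 0#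

  seqMatrix : ∀ {n} → Matrix n → Matrix n
  seqMatrix N i j = seqMap N (basis j) i

  Regular : ∀ {n} → Matrix n → Set ℓ
  Regular N = ∀ i → N i i ≈ 1#

  Similar : ∀ {n} → Matrix n → Matrix n → Set ℓ
  Similar M' M = ∀ i j → ¬ (i ≡ j) → M' i j ≈ M i j

-- Write Y = N↓(X).  When instruction i runs, the entries below i already hold
-- their new values, so Y is the unique solution of the forward-substitution
-- system  Y i = Σ_j N i j · (Y below i, X from i on) j.
-- For a (1+n)-matrix M take N with first row (1, M 0 1, …), lower-right block
-- A and a first column chosen so that N↓ sends e₀ to (1, M 1 0, …).  Then the
-- remaining columns of N^s are those of A^s plus the rank-one term
-- M (1+i) 0 · M 0 (1+j), so A has to realise the Schur complement
-- M (1+i) (1+j) − M (1+i) 0 · M 0 (1+j) off the diagonal: recurse.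
-- No inverses are used; the argument works over any commutative ring.
module Submission where

open import Defs
open import Level using (Level)
open import Data.Nat using (ℕ; zero; suc)
open import Data.Fin using (Fin; zero; suc)
open import Data.List using (List; []; _∷_; map; allFin)
open import Data.List.Properties using (map-tabulate)
open import Data.Vec.Functional as Vector using (Vector; updateAt; tail)
open import Data.Product using (Σ; _×_; _,_; proj₁; proj₂)
open import Data.Empty using (⊥-elim)
open import Function using (id)
open import Relation.Binary.PropositionalEquality as ≡ using (_≡_)
import Algebra.Properties.Ring as RingProperties
import Algebra.Properties.Group as GroupProperties
import Algebra.Properties.CommutativeSemigroup as CommutativeSemigroupProperties
import Algebra.Properties.Semiring.Sum as SemiringSum
import Data.Vec.Functional.Relation.Binary.Equality.Setoid as VectorEquality

allFin-suc : ∀ n → allFin (suc n) ≡ zero ∷ map suc (allFin n)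
allFin-suc n = ≡.cong (zero ∷_) (≡.sym (map-tabulate id suc))

module Regularization {c ℓ : Level} (K : Field c ℓ) where
  open Field K hiding (zero)
  open FieldMatrices K
  open RingProperties ring using (-‿distribˡ-*)
  open GroupProperties +-group using (//-rightDividesˡ)
  open CommutativeSemigroupProperties +-commutativeSemigroup using (interchange)
  open SemiringSum semiring using (sum; sum-cong-≋; ∑-distrib-+; *-distribʳ-sum; sum-replicate-zero)
  open VectorEquality setoid using (_≋_; ≋-refl; ≋-sym; ≋-trans)
  open import Relation.Binary.Reasoning.Setoid setoid

  +-*-regroup : ∀ w x s r → w + x * r ≈ (x - s) * r + (w + s * r)
  +-*-regroup w x s r = sym (begin
    (x - s) * r + (w + s * r)         ≈⟨ +-congʳ (trans (distribʳ r x (- s)) (+-congˡ (sym (-‿distribˡ-* s r)))) ⟩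
    (x * r - s * r) + (w + s * r)     ≈⟨ interchange (x * r) (- (s * r)) w (s * r) ⟩
    (x * r + w) + (- (s * r) + s * r) ≈⟨ +-congˡ (-‿inverseˡ (s * r)) ⟩
    (x * r + w) + 0#                  ≈⟨ +-identityʳ _ ⟩
    x * r + w                         ≈⟨ +-comm _ w ⟩
    w + x * r                         ∎)

  ∑≡sum : ∀ {n} (f : Vector Carrier n) → ∑ f ≡ sum f
  ∑≡sum {zero}  f = ≡.refl
  ∑≡sum {suc n} f = ≡.cong (f zero +_) (∑≡sum (tail f))

  infix 7 _·_
  _·_ : ∀ {n} → Vector Carrier n → Vector Carrier n → Carrier
  u · v = sum (λ k → u k * v k)

  ·-congˡ : ∀ {n} (u : Vector Carrier n) {v w} → v ≋ w → u · v ≈ u · w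
  ·-congˡ u v≋w = sum-cong-≋ (λ k → *-congˡ (v≋w k))

  ·-zeroʳ : ∀ {n} (u : Vector Carrier n) → u · (λ _ → 0#) ≈ 0#
  ·-zeroʳ {n} u = trans (sum-cong-≋ (λ k → zeroʳ (u k))) (sum-replicate-zero n)

  ·-basis : ∀ {n} (u : Vector Carrier n) j → u · basis j ≈ u j
  ·-basis {suc n} u zero    = trans (+-cong (*-identityʳ _) (·-zeroʳ (tail u))) (+-identityʳ _)
  ·-basis {suc n} u (suc j) = trans (+-cong (zeroʳ _) (·-basis (tail u) j)) (+-identityˡ _)

  ·-linearʳ : ∀ {n} (u v w : Vector Carrier n) a →
              u · (λ k → v k + w k * a) ≈ u · v + (u · w) * a
  ·-linearʳ u v w a = begin
    u · (λ k → v k + w k * a)                  ≈⟨ sum-cong-≋ (λ k → distribˡ (u k) (v k) (w k * a)) ⟩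
    sum (λ k → u k * v k + u k * (w k * a))    ≈⟨ ∑-distrib-+ (λ k → u k * v k) (λ k → u k * (w k * a)) ⟩
    u · v + sum (λ k → u k * (w k * a))        ≈⟨ +-congˡ (sum-cong-≋ (λ k → sym (*-assoc (u k) (w k) a))) ⟩
    u · v + sum (λ k → u k * w k * a)          ≈⟨ +-congˡ (*-distribʳ-sum a (λ k → u k * w k)) ⟨
    u · v + (u · w) * a                        ∎

  updateAt-cong : ∀ {n} {X Y : Vector Carrier n} i {a b} → X ≋ Y → a ≈ b →
                  updateAt X i (λ _ → a) ≋ updateAt Y i (λ _ → b)
  updateAt-cong zero    X≋Y a≈b zero    = a≈b
  updateAt-cong zero    X≋Y a≈b (suc k) = X≋Y (suc k)
  updateAt-cong (suc i) X≋Y a≈b zero    = X≋Y zero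
  updateAt-cong (suc i) X≋Y a≈b (suc k) = updateAt-cong i (λ k → X≋Y (suc k)) a≈b k

  -- The programs of the lower-right block need an inhomogeneous term o,
  -- through which the (already computed) first entry enters.
  affineStep : ∀ {n} → Matrix n → Vector Carrier n → Fin n → Vector Carrier n → Vector Carrier n
  affineStep N o i X = updateAt X i (λ _ → o i + N i · X)

  affineRun : ∀ {n} → Matrix n → Vector Carrier n → List (Fin n) → Vector Carrier n → Vector Carrier n
  affineRun N o []       X = X
  affineRun N o (i ∷ is) X = affineRun N o is (affineStep N o i X)

  affineRun-cong : ∀ {n} (N : Matrix n) {o o′} is {X Y} → o ≋ o′ → X ≋ Y →
                   affineRun N o is X ≋ affineRun N o′ is Y
  affineRun-cong N []       o≋o′ X≋Y = X≋Y
  affineRun-cong N (i ∷ is) o≋o′ X≋Y =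
    affineRun-cong N is o≋o′ (updateAt-cong i X≋Y (+-cong (o≋o′ i) (·-congˡ (N i) X≋Y)))

  run≋affineRun : ∀ {n} (N : Matrix n) is X → run N is X ≋ affineRun N (λ _ → 0#) is X
  run≋affineRun N []       X = ≋-refl
  run≋affineRun N (i ∷ is) X = ≋-trans (run≋affineRun N is (step N i X))
    (affineRun-cong N is ≋-refl (updateAt-cong i ≋-refl
      (trans (reflexive (∑≡sum (λ j → N i j * X j))) (sym (+-identityˡ _)))))

  lowerRight : ∀ {n} → Matrix (suc n) → Matrix n
  lowerRight N i j = N (suc i) (suc j)

  tailOffset : ∀ {n} → Matrix (suc n) → Vector Carrier (suc n) → Carrier → Vector Carrier n
  tailOffset N o a i = o (suc i) + N (suc i) zero * a

  affineRun-map-suc : ∀ {n} (N : Matrix (suc n)) o is V {W} → tail V ≋ W →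
    affineRun N o (map suc is) V zero ≡ V zero ×
    tail (affineRun N o (map suc is) V) ≋ affineRun (lowerRight N) (tailOffset N o (V zero)) is W
  affineRun-map-suc N o []       V V≋W = ≡.refl , V≋W
  affineRun-map-suc N o (i ∷ is) V V≋W = affineRun-map-suc N o is (affineStep N o (suc i) V)
    (updateAt-cong i V≋W (trans (sym (+-assoc _ _ _)) (+-congˡ (·-congˡ (lowerRight N i) V≋W))))

  -- splice i Y X takes its entries below i from Y and the others from X: the
  -- memory just before instruction i, when Y is the output and X the input.
  splice : ∀ {n} → Fin n → Vector Carrier n → Vector Carrier n → Vector Carrier n
  splice zero    Y X k       = X k
  splice (suc i) Y X zero    = Y zero
  splice (suc i) Y X (suc k) = splice i (tail Y) (tail X) k

  splice-cong : ∀ {n} (i : Fin n) {Y Y′ X X′} → Y ≋ Y′ → X ≋ X′ → splice i Y X ≋ splice i Y′ X′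
  splice-cong zero    Y≋Y′ X≋X′ k       = X≋X′ k
  splice-cong (suc i) Y≋Y′ X≋X′ zero    = Y≋Y′ zero
  splice-cong (suc i) Y≋Y′ X≋X′ (suc k) = splice-cong i (λ k → Y≋Y′ (suc k)) (λ k → X≋X′ (suc k)) k

  splice-linear : ∀ {n} (i : Fin n) (Y Q X : Vector Carrier n) a k →
    splice i (λ k → Y k + Q k * a) X k ≈ splice i Y X k + splice i Q (λ _ → 0#) k * a
  splice-linear zero    Y Q X a k       = sym (trans (+-congˡ (zeroˡ a)) (+-identityʳ _))
  splice-linear (suc i) Y Q X a zero    = refl
  splice-linear (suc i) Y Q X a (suc k) = splice-linear i (tail Y) (tail Q) (tail X) a k

  Solves : ∀ {n} → Matrix n → Vector Carrier n → Vector Carrier n → Vector Carrier n → Set ℓ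
  Solves N o X Y = ∀ i → Y i ≈ o i + N i · splice i Y X

  Solves-resp : ∀ {n} (N : Matrix n) {o o′ X Y Y′} → o ≋ o′ → Y ≋ Y′ →
                Solves N o X Y → Solves N o′ X Y′
  Solves-resp N o≋o′ Y≋Y′ solves i =
    trans (sym (Y≋Y′ i)) (trans (solves i) (+-cong (o≋o′ i) (·-congˡ (N i) (splice-cong i Y≋Y′ ≋-refl))))

  Solves-tail : ∀ {n} (N : Matrix (suc n)) {o X Y} → Solves N o X Y →
                Solves (lowerRight N) (tailOffset N o (Y zero)) (tail X) (tail Y)
  Solves-tail N solves i = trans (solves (suc i)) (sym (+-assoc _ _ _))

  Solves-fromTail : ∀ {n} (N : Matrix (suc n)) {o X Y} → Y zero ≈ o zero + N zero · X →
                    Solves (lowerRight N) (tailOffset N o (Y zero)) (tail X) (tail Y) → Solves N o X Y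
  Solves-fromTail N head-solves tail-solves zero    = head-solves
  Solves-fromTail N head-solves tail-solves (suc i) = trans (tail-solves i) (+-assoc _ _ _)

  affineRun-solves : ∀ {n} (N : Matrix n) o X → Solves N o X (affineRun N o (allFin n) X)
  affineRun-solves {zero}  N o X ()
  affineRun-solves {suc n} N o X =
    ≡.subst (Solves N o X) (≡.cong (λ is → affineRun N o is X) (≡.sym (allFin-suc n))) solves
    where
      V = affineStep N o zero X
      head≡ = proj₁ (affineRun-map-suc N o (allFin n) V ≋-refl)
      tail≋ = proj₂ (affineRun-map-suc N o (allFin n) V ≋-refl)
      solves : Solves N o X (affineRun N o (map suc (allFin n)) V)
      solves = Solves-fromTail N (reflexive head≡)
        (Solves-resp (lowerRight N) (λ i → +-congˡ (*-congˡ (reflexive (≡.sym head≡)))) (≋-sym tail≋)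
          (affineRun-solves (lowerRight N) _ (tail X)))

  Solves-unique : ∀ {n} (N : Matrix n) {o X Y Y′} → Solves N o X Y → Solves N o X Y′ → Y ≋ Y′
  Solves-unique {zero}  N solves solves′ ()
  Solves-unique {suc n} N solves solves′ zero    = trans (solves zero) (sym (solves′ zero))
  Solves-unique {suc n} N solves solves′ (suc i) =
    Solves-unique (lowerRight N) (Solves-tail N solves)
      (Solves-resp (lowerRight N) (λ k → +-congˡ (*-congˡ (sym heads≈))) ≋-refl (Solves-tail N solves′)) i
    where heads≈ = trans (solves zero) (sym (solves′ zero))

  seqMap-solves : ∀ {n} (N : Matrix n) X → Solves N (λ _ → 0#) X (seqMap N X)
  seqMap-solves {n} N X =
    Solves-resp N ≋-refl (≋-sym (run≋affineRun N (allFin n) X)) (affineRun-solves N _ X)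

  seqMap-unique : ∀ {n} (N : Matrix n) {X Y} → Solves N (λ _ → 0#) X Y → seqMap N X ≋ Y
  seqMap-unique N {X} = Solves-unique N (seqMap-solves N X)

  schurComplement : ∀ {n} → Matrix (suc n) → Matrix n
  schurComplement M i j = M (suc i) (suc j) - M (suc i) zero * M zero (suc j)

  firstColumn : ∀ {n} → Matrix (suc n) → Vector Carrier n
  firstColumn M i = M (suc i) zero

  -- Instruction 1+i adds A i · (entries computed so far) to border M A (1+i) 0 · x₀;
  -- on e₀ those entries are firstColumn M, so instruction 1+i outputs M (1+i) 0.
  border : ∀ {n} → Matrix (suc n) → Matrix n → Matrix (suc n)
  border M A zero    zero    = 1#
  border M A zero    (suc j) = M zero (suc j)
  border M A (suc i) zero    = firstColumn M i - A i · splice i (firstColumn M) (λ _ → 0#)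
  border M A (suc i) (suc j) = A i j

  module _ {n} (M : Matrix (suc n)) (A : Matrix n) where
    private
      N = border M A
      m = firstColumn M

    seqMap-border-basis-zero : seqMap N (basis zero) ≋ 1# Vector.∷ m
    seqMap-border-basis-zero = seqMap-unique N solves
      where
        solves : Solves N (λ _ → 0#) (basis zero) (1# Vector.∷ m)
        solves zero    = sym (trans (+-identityˡ _) (·-basis (N zero) zero))
        solves (suc i) = sym (trans (+-identityˡ _)
          (trans (+-congʳ (*-identityʳ _)) (//-rightDividesˡ _ (m i))))

    seqMap-border-basis-suc : ∀ j →
      seqMap N (basis (suc j)) ≋ M zero (suc j) Vector.∷ (λ i → seqMatrix A i j + m i * M zero (suc j))
    seqMap-border-basis-suc j = seqMap-unique N solves
      where
        r = M zero (suc j)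
        W = seqMap A (basis j)
        solves : Solves N (λ _ → 0#) (basis (suc j)) (r Vector.∷ (λ i → W i + m i * r))
        solves zero    = sym (trans (+-identityˡ _) (·-basis (N zero) (suc j)))
        solves (suc i) = begin
          W i + m i * r                    ≈⟨ +-congʳ (trans (seqMap-solves A (basis j) i) (+-identityˡ _)) ⟩
          w + m i * r                      ≈⟨ +-*-regroup w (m i) s r ⟩
          (m i - s) * r + (w + s * r)      ≈⟨ +-congˡ (·-linearʳ (A i) _ _ r) ⟨
          (m i - s) * r + A i · (λ k → splice i W (basis j) k + splice i m (λ _ → 0#) k * r)
            ≈⟨ +-congˡ (·-congˡ (A i) (splice-linear i W m (basis j) r)) ⟨
          (m i - s) * r + A i · splice i (λ k → W k + m k * r) (basis j)
            ≈⟨ +-identityˡ _ ⟨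
          0# + ((m i - s) * r + A i · splice i (λ k → W k + m k * r) (basis j)) ∎
          where
            w = A i · splice i W (basis j)
            s = A i · splice i m (λ _ → 0#)

  regularize : ∀ {n} → Matrix n → Matrix n
  regularize {zero}  M = M
  regularize {suc n} M = border M (regularize (schurComplement M))

  regularize-regular : ∀ {n} (M : Matrix n) → Regular (regularize M)
  regularize-regular {suc n} M zero    = refl
  regularize-regular {suc n} M (suc i) = regularize-regular (schurComplement M) i

  regularize-similar : ∀ {n} (M : Matrix n) → Similar (seqMatrix (regularize M)) M
  regularize-similar {suc n} M zero    zero    0≢0 = ⊥-elim (0≢0 ≡.refl)
  regularize-similar {suc n} M zero    (suc j) _   = seqMap-border-basis-suc M _ j zero
  regularize-similar {suc n} M (suc i) zero    _   = seqMap-border-basis-zero M _ (suc i)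
  regularize-similar {suc n} M (suc i) (suc j) i≢j = begin
    seqMatrix (regularize M) (suc i) (suc j)                    ≈⟨ seqMap-border-basis-suc M _ j (suc i) ⟩
    seqMatrix (regularize M′) i j + M (suc i) zero * M zero (suc j)
      ≈⟨ +-congʳ (regularize-similar M′ i j (λ i≡j → i≢j (≡.cong suc i≡j))) ⟩
    M′ i j + M (suc i) zero * M zero (suc j)                    ≈⟨ //-rightDividesˡ _ _ ⟩
    M (suc i) (suc j)                                           ∎
    where M′ = schurComplement M

theorem2 : {c ℓ : Level} (K : Field c ℓ) (n : ℕ) (M : FieldMatrices.Matrix K n) →
    Σ (FieldMatrices.Matrix K n) λ dM →
    FieldMatrices.Regular K dM × FieldMatrices.Similar K (FieldMatrices.seqMatrix K dM) M
theorem2 K n M = regularize M , regularize-regular M , regularize-similar M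
  where open Regularization K
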